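{- For all integers $d\geq 2$, $k\geq 2$ and $r\geq 2d+2$, there exists a claw-free $r$-regular graph on $(r+1)k$ vertices that has no $d$-cut.
   Context: All graphs are finite, simple and undirected. A graph is claw-free if it contains no induced subgraph isomorphic to $K_{1,3}$. A graph is $r$-regular if every vertex has degree exactly $r$. For an integer $d\geq 1$ and a graph $G=(V,E)$, a set $M\subseteq E$ is a $d$-cut of $G$ if $V$ can be partitioned into two non-empty sets $B$ and $R$ such that $M$ is exactly the set of edges with one end in $B$ and the other in $R$, and every vertex of $B$ has at most $d$ neighbours in $R$ and every vertex of $R$ has at most $d$ neighbours in $B$. -}

module Defs where

open import Data.Nat using (ℕ; zero; suc; _+_; _≤_)
open import Data.Fin using (Fin)
open import Data.Bool using (Bool; true; false; T; not; _∧_; _xor_)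
open import Data.Product using (Σ; ∃; _×_; _,_)
open import Relation.Binary.PropositionalEquality using (_≡_; _≢_)
open import Relation.Nullary using (¬_)

record Graph (n : ℕ) : Set where
  field
    adj       : Fin n → Fin n → Bool
    adj-sym   : ∀ u v → adj u v ≡ adj v u
    adj-irrefl : ∀ v → adj v v ≡ false
open Graph public

countTrue : ∀ {n} → (Fin n → Bool) → ℕ
countTrue {zero}  f = 0
countTrue {suc n} f = (if' (f Fin.zero)) + countTrue (λ i → f (Fin.suc i))
  where
  if' : Bool → ℕ
  if' true  = 1
  if' false = 0

degree : ∀ {n} → Graph n → Fin n → ℕ
degree G v = countTrue (adj G v)

Regular : ∀ {n} → ℕ → Graph n → Set
Regular r G = ∀ v → degree G v ≡ r

ClawFree : ∀ {n} → Graph n → Set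
ClawFree G = ∀ v a b c →
  T (adj G v a) → T (adj G v b) → T (adj G v c) →
  a ≢ b → a ≢ c → b ≢ c →
  ¬ (adj G a b ≡ false × adj G a c ≡ false × adj G b c ≡ false)

-- A bipartition (B , R) of the vertex set, encoded by side : Fin n → Bool
-- (true = B, false = R), is a d-cut partition if both parts are non-empty
-- and every vertex has at most d neighbours on the other side.
IsDCutPartition : ∀ {n} → ℕ → Graph n → (Fin n → Bool) → Set
IsDCutPartition d G side =
  (∃ λ b → side b ≡ true) × (∃ λ r → side r ≡ false) ×
  (∀ v → countTrue (λ u → adj G v u ∧ (side v xor side u)) ≤ d)

CutEdges : ∀ {n} → Graph n → (Fin n → Bool) → Fin n → Fin n → Bool
CutEdges G side u v = adj G u v ∧ (side u xor side v)

IsDCut : ∀ {n} → ℕ → Graph n → (Fin n → Fin n → Bool) → Set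
IsDCut d G M = Σ (_ → Bool) λ side →
  IsDCutPartition d G side × (∀ u v → M u v ≡ CutEdges G side u v)

HasDCut : ∀ {n} → ℕ → Graph n → Set
HasDCut {n} d G = ∃ λ (M : Fin n → Fin n → Bool) → IsDCut d G M

module Submission where

-- Write r = 2p + e with e ∈ {0, 1}, so that d < p. Arrange n = (r + 1)k vertices in a cycle,
-- join each vertex to the p nearest vertices on either side and, if e = 1, add the chords
-- x — x + p + 1 for x in alternating blocks of p + 1 consecutive residues; as 2(p + 1) divides n,
-- these chords form a perfect matching and the graph is r-regular. The neighbours of v lie in the
-- two arcs of p + 1 vertices beside v, each a clique, so any three of them span an edge. Given a
-- bipartition (B, R), walk around the cycle to some i ∈ B with i + 1 ∈ R: each of the 2p vertices
-- i − p + 1, …, i + p is adjacent to both i and i + 1, hence across the cut from one of them, so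
-- i or i + 1 has more than d neighbours on the other side.

open import Defs
open import Data.Nat
open import Data.Nat.Properties
open import Data.Nat.DivMod
open import Data.Nat.Divisibility using (_∣_; divides; ∣⇒≤)
open import Data.Nat.Tactic.RingSolver using (solve-∀)
open import Data.Fin using (Fin; toℕ; fromℕ<) renaming (zero to fzero; suc to fsuc)
open import Data.Fin.Properties using (toℕ<n; toℕ-injective; toℕ-fromℕ<)
open import Data.Bool using (Bool; true; false; T; not; _∧_; _∨_; _xor_)
open import Data.Bool.Properties using (∨-comm; ∨-zeroʳ; ∨-identityʳ; ∧-zeroʳ; ∧-identityʳ; T-∧; T-∨)
open import Function.Bundles using (Equivalence)
open import Data.Product using (Σ; ∃; ∃₂; _×_; _,_; proj₁; proj₂)
open import Data.Sum using (_⊎_; inj₁; inj₂)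
open import Function using (_∘_)
open import Relation.Binary.PropositionalEquality
open import Relation.Binary.Definitions using (tri<; tri≈; tri>)
open import Relation.Nullary using (¬_; Dec; yes; no; does; contradiction)
open import Relation.Nullary.Decidable using (dec-true; dec-false)

bit : Bool → ℕ
bit true  = 1
bit false = 0

count : (ℕ → Bool) → ℕ → ℕ → ℕ
count g a zero    = 0
count g a (suc l) = bit (g a) + count g (suc a) l

count-one : ∀ g a → count g a 1 ≡ bit (g a)
count-one g a = +-identityʳ _

count-++ : ∀ g a l₁ l₂ → count g a (l₁ + l₂) ≡ count g a l₁ + count g (a + l₁) l₂
count-++ g a zero     l₂ = cong (λ b → count g b l₂) (sym (+-identityʳ a))
count-++ g a (suc l₁) l₂ = begin
  bit (g a) + count g (suc a) (l₁ + l₂)                    ≡⟨ cong (bit (g a) +_) (count-++ g (suc a) l₁ l₂) ⟩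
  bit (g a) + (count g (suc a) l₁ + count g (suc a + l₁) l₂) ≡⟨ sym (+-assoc (bit (g a)) _ _) ⟩
  bit (g a) + count g (suc a) l₁ + count g (suc a + l₁) l₂ ≡⟨ cong (λ b → count g a (suc l₁) + count g b l₂) (sym (+-suc a l₁)) ⟩
  bit (g a) + count g (suc a) l₁ + count g (a + suc l₁) l₂ ∎
  where open ≡-Reasoning

count-shift : ∀ g a l → count g a l ≡ count (λ t → g (a + t)) 0 l
count-shift g a l = trans (cong (λ z → count g z l) (sym (+-identityʳ a))) (shift 0 l)
  where
  shift : ∀ b l → count g (a + b) l ≡ count (λ t → g (a + t)) b l
  shift b zero    = refl
  shift b (suc l) = cong (bit (g (a + b)) +_)
    (trans (cong (λ z → count g z l) (sym (+-suc a b))) (shift (suc b) l))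

OnRange : ℕ → ℕ → (ℕ → Set) → Set
OnRange a l P = ∀ t → a ≤ t → t < a + l → P t

OnRange-tail : ∀ {a l P} → OnRange a (suc l) P → OnRange (suc a) l P
OnRange-tail {a} {l} h t a<t t<a+l = h t (<⇒≤ a<t) (subst (t <_) (sym (+-suc a l)) t<a+l)

OnRange-head : ∀ {a l P} → OnRange a (suc l) P → P a
OnRange-head {a} {l} h = h a ≤-refl (subst (a <_) (sym (+-suc a l)) (s≤s (m≤m+n a l)))

count-cong : ∀ {f g} a l → OnRange a l (λ t → f t ≡ g t) → count f a l ≡ count g a l
count-cong a zero    h = refl
count-cong a (suc l) h = cong₂ _+_ (cong bit (OnRange-head h)) (count-cong (suc a) l (OnRange-tail h))

count-true : ∀ {g} a l → OnRange a l (λ t → g t ≡ true) → count g a l ≡ l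
count-true a zero    h = refl
count-true a (suc l) h rewrite OnRange-head h = cong suc (count-true (suc a) l (OnRange-tail h))

count-false : ∀ {g} a l → OnRange a l (λ t → g t ≡ false) → count g a l ≡ 0
count-false a zero    h = refl
count-false a (suc l) h rewrite OnRange-head h = count-false (suc a) l (OnRange-tail h)

count-subrange : ∀ g a l n → a + l ≤ n → count g a l ≤ count g 0 n
count-subrange g a l n a+l≤n = begin
  count g a l                                    ≤⟨ m≤n+m _ _ ⟩
  count g 0 a + count g a l                      ≡⟨ sym (count-++ g 0 a l) ⟩
  count g 0 (a + l)                              ≤⟨ m≤m+n _ _ ⟩
  count g 0 (a + l) + count g (a + l) (n ∸ (a + l)) ≡⟨ sym (count-++ g 0 (a + l) _) ⟩
  count g 0 (a + l + (n ∸ (a + l)))              ≡⟨ cong (count g 0) (m+[n∸m]≡n a+l≤n) ⟩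
  count g 0 n ∎
  where open ≤-Reasoning

bit-∨ : ∀ x y → bit (x ∨ y) ≤ bit x + bit y
bit-∨ true  y = s≤s z≤n
bit-∨ false y = ≤-refl

count-∨ : ∀ f g a l → count (λ t → f t ∨ g t) a l ≤ count f a l + count g a l
count-∨ f g a zero    = z≤n
count-∨ f g a (suc l) = begin
  bit (f a ∨ g a) + count (λ t → f t ∨ g t) (suc a) l       ≤⟨ +-mono-≤ (bit-∨ (f a) (g a)) (count-∨ f g (suc a) l) ⟩
  bit (f a) + bit (g a) + (count f (suc a) l + count g (suc a) l) ≡⟨ +-comm-middle (bit (f a)) _ _ _ ⟩
  bit (f a) + count f (suc a) l + (bit (g a) + count g (suc a) l) ∎
  where
  open ≤-Reasoning
  +-comm-middle : ∀ w x y z → w + x + (y + z) ≡ w + y + (x + z)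
  +-comm-middle = solve-∀

countTrue-cong : ∀ {n} {f g : Fin n → Bool} → (∀ j → f j ≡ g j) → countTrue f ≡ countTrue g
countTrue-cong {zero}  f≗g = refl
countTrue-cong {suc n} {f} {g} f≗g with f fzero | g fzero | f≗g fzero
... | true  | .true  | refl = cong suc (countTrue-cong (f≗g ∘ fsuc))
... | false | .false | refl = countTrue-cong (f≗g ∘ fsuc)

countTrue≡count : ∀ {n} (g : ℕ → Bool) → countTrue {n} (g ∘ toℕ) ≡ count g 0 n
countTrue≡count {zero}  g = refl
countTrue≡count {suc n} g with g 0
... | true  = cong suc (trans (countTrue≡count {n} (g ∘ suc)) (sym (count-shift g 1 n)))
... | false = trans (countTrue≡count {n} (g ∘ suc)) (sym (count-shift g 1 n))

extend : ∀ {n} → (Fin n → Bool) → ℕ → Bool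
extend {zero}  f t       = false
extend {suc n} f zero    = f fzero
extend {suc n} f (suc t) = extend (f ∘ fsuc) t

extend-toℕ : ∀ {n} (f : Fin n → Bool) j → extend f (toℕ j) ≡ f j
extend-toℕ f fzero    = refl
extend-toℕ f (fsuc j) = extend-toℕ (f ∘ fsuc) j

pigeonhole : ∀ {A : Set} {P Q : A → Set} (R : A → A → Set) →
             (∀ {x y} → P x → P y → R x y) → (∀ {x y} → Q x → Q y → R x y) →
             ∀ {a b c} → P a ⊎ Q a → P b ⊎ Q b → P c ⊎ Q c → R a b ⊎ R a c ⊎ R b c
pigeonhole R PP QQ (inj₁ a) (inj₁ b) _        = inj₁ (PP a b)
pigeonhole R PP QQ (inj₂ a) (inj₂ b) _        = inj₁ (QQ a b)
pigeonhole R PP QQ (inj₁ a) (inj₂ b) (inj₁ c) = inj₂ (inj₁ (PP a c))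
pigeonhole R PP QQ (inj₁ a) (inj₂ b) (inj₂ c) = inj₂ (inj₂ (QQ b c))
pigeonhole R PP QQ (inj₂ a) (inj₁ b) (inj₁ c) = inj₂ (inj₂ (PP b c))
pigeonhole R PP QQ (inj₂ a) (inj₁ b) (inj₂ c) = inj₂ (inj₁ (QQ a c))

does-witness : ∀ {A : Set} (a? : Dec A) → T (does a?) → A
does-witness (yes a) _ = a

true→false-step : ∀ (g : ℕ → Bool) m → g 0 ≡ true → g m ≡ false →
                  ∃ λ t → g t ≡ true × g (suc t) ≡ false
true→false-step g zero    g0 gm = contradiction (trans (sym g0) gm) λ ()
true→false-step g (suc m) g0 gm with g m in gm′
... | true  = m , gm′ , gm
... | false = true→false-step g m g0 gm′

%-absorbˡ : ∀ a b d .{{_ : NonZero d}} → (a % d + b) % d ≡ (a + b) % d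
%-absorbˡ a b d = begin
  (a % d + b) % d           ≡⟨ %-distribˡ-+ (a % d) b d ⟩
  (a % d % d + b % d) % d   ≡⟨ cong (λ z → (z + b % d) % d) (m%n%n≡m%n a d) ⟩
  (a % d + b % d) % d       ≡⟨ sym (%-distribˡ-+ a b d) ⟩
  (a + b) % d               ∎
  where open ≡-Reasoning

%-absorbʳ : ∀ a b d .{{_ : NonZero d}} → (a + b % d) % d ≡ (a + b) % d
%-absorbʳ a b d = begin
  (a + b % d) % d ≡⟨ cong (_% d) (+-comm a (b % d)) ⟩
  (b % d + a) % d ≡⟨ %-absorbˡ b a d ⟩
  (b + a) % d     ≡⟨ cong (_% d) (+-comm b a) ⟩
  (a + b) % d     ∎
  where open ≡-Reasoning

module Cyclic (n : ℕ) {{_ : NonZero n}} where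

  infixl 6 _⊕_ _⊖_

  _⊕_ : ℕ → ℕ → ℕ
  x ⊕ m = (x + m) % n

  _⊖_ : ℕ → ℕ → ℕ
  y ⊖ x = (y + (n ∸ x)) % n

  ⊕<n : ∀ x m → x ⊕ m < n
  ⊕<n x m = m%n<n (x + m) n

  ⊖<n : ∀ y x → y ⊖ x < n
  ⊖<n y x = m%n<n (y + (n ∸ x)) n

  ⊕-assoc : ∀ x a b → x ⊕ a ⊕ b ≡ x ⊕ (a + b)
  ⊕-assoc x a b = trans (%-absorbˡ (x + a) b n) (cong (_% n) (+-assoc x a b))

  ⊕-identityʳ : ∀ {x} → x < n → x ⊕ 0 ≡ x
  ⊕-identityʳ {x} x<n = trans (cong (_% n) (+-identityʳ x)) (m<n⇒m%n≡m x<n)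

  ⊕-period : ∀ x a → x ⊕ (a + n) ≡ x ⊕ a
  ⊕-period x a = trans (cong (_% n) (sym (+-assoc x a n))) ([m+n]%n≡m%n (x + a) n)

  ⊕-cancel : ∀ {x} a b → x < n → a + b ≡ n → x ⊕ a ⊕ b ≡ x
  ⊕-cancel {x} a b x<n a+b≡n = begin
    x ⊕ a ⊕ b        ≡⟨ ⊕-assoc x a b ⟩
    x ⊕ (a + b)      ≡⟨ cong (x ⊕_) a+b≡n ⟩
    x ⊕ (0 + n)      ≡⟨ ⊕-period x 0 ⟩
    x ⊕ 0            ≡⟨ ⊕-identityʳ x<n ⟩
    x                ∎
    where open ≡-Reasoning

  ⊕-⊖ : ∀ {x y} → x < n → y < n → x ⊕ (y ⊖ x) ≡ y
  ⊕-⊖ {x} {y} x<n y<n = begin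
    (x + (y + (n ∸ x)) % n) % n ≡⟨ %-absorbʳ x (y + (n ∸ x)) n ⟩
    (x + (y + (n ∸ x))) % n     ≡⟨ cong (_% n) (x+[y+z]≡y+[x+z] x y (n ∸ x)) ⟩
    (y + (x + (n ∸ x))) % n     ≡⟨ cong (λ z → (y + z) % n) (m+[n∸m]≡n (<⇒≤ x<n)) ⟩
    (y + n) % n                 ≡⟨ [m+n]%n≡m%n y n ⟩
    y % n                       ≡⟨ m<n⇒m%n≡m y<n ⟩
    y                           ∎
    where
    open ≡-Reasoning
    x+[y+z]≡y+[x+z] : ∀ x y z → x + (y + z) ≡ y + (x + z)
    x+[y+z]≡y+[x+z] = solve-∀

  ⊖-⊕ : ∀ {x m} → x < n → m < n → x ⊕ m ⊖ x ≡ m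
  ⊖-⊕ {x} {m} x<n m<n = begin
    ((x + m) % n + (n ∸ x)) % n ≡⟨ %-absorbˡ (x + m) (n ∸ x) n ⟩
    (x + m + (n ∸ x)) % n       ≡⟨ cong (_% n) ([x+y]+z≡y+[x+z] x m (n ∸ x)) ⟩
    (m + (x + (n ∸ x))) % n     ≡⟨ cong (λ z → (m + z) % n) (m+[n∸m]≡n (<⇒≤ x<n)) ⟩
    (m + n) % n                 ≡⟨ [m+n]%n≡m%n m n ⟩
    m % n                       ≡⟨ m<n⇒m%n≡m m<n ⟩
    m                           ∎
    where
    open ≡-Reasoning
    [x+y]+z≡y+[x+z] : ∀ x y z → x + y + z ≡ y + (x + z)
    [x+y]+z≡y+[x+z] = solve-∀

  ⊖-injective : ∀ {v x y} → v < n → x < n → y < n → x ⊖ v ≡ y ⊖ v → x ≡ y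
  ⊖-injective v<n x<n y<n eq =
    trans (sym (⊕-⊖ v<n x<n)) (trans (cong (_ ⊕_) eq) (⊕-⊖ v<n y<n))

  ⊖-self : ∀ {x} → x < n → x ⊖ x ≡ 0
  ⊖-self x<n = trans (cong (_% n) (m+[n∸m]≡n (<⇒≤ x<n))) (n%n≡0 n)

  ⊖-shift : ∀ c {a b} → a ≤ b → b < n → c ⊕ b ⊖ (c ⊕ a) ≡ b ∸ a
  ⊖-shift c {a} {b} a≤b b<n = begin
    c ⊕ b ⊖ (c ⊕ a)               ≡⟨ cong (λ z → c ⊕ z ⊖ (c ⊕ a)) (sym (m+[n∸m]≡n a≤b)) ⟩
    c ⊕ (a + (b ∸ a)) ⊖ (c ⊕ a)   ≡⟨ cong (_⊖ (c ⊕ a)) (sym (⊕-assoc c a (b ∸ a))) ⟩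
    c ⊕ a ⊕ (b ∸ a) ⊖ (c ⊕ a)     ≡⟨ ⊖-⊕ (⊕<n c a) (≤-<-trans (m∸n≤m b a) b<n) ⟩
    b ∸ a                         ∎
    where open ≡-Reasoning

  ⊖-⊕-back : ∀ {x m} → x < n → 0 < m → m < n → x ⊖ (x ⊕ m) ≡ n ∸ m
  ⊖-⊕-back {x} {m} x<n 0<m m<n = begin
    x ⊖ (x ⊕ m)                 ≡⟨ cong (_⊖ (x ⊕ m)) (sym (⊕-cancel m (n ∸ m) x<n (m+[n∸m]≡n (<⇒≤ m<n)))) ⟩
    x ⊕ m ⊕ (n ∸ m) ⊖ (x ⊕ m)   ≡⟨ ⊖-⊕ (⊕<n x m) (∸-monoʳ-< 0<m (<⇒≤ m<n)) ⟩
    n ∸ m                       ∎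
    where open ≡-Reasoning

  true→false-around : ∀ (s : ℕ → Bool) {b r} → b < n → r < n → s b ≡ true → s r ≡ false →
                      ∃ λ i → i < n × s i ≡ true × s (i ⊕ 1) ≡ false
  true→false-around s {b} {r} b<n r<n b∈B r∈R with true→false-step (λ t → s (b ⊕ t)) (r ⊖ b)
      (trans (cong s (⊕-identityʳ b<n)) b∈B) (trans (cong s (⊕-⊖ b<n r<n)) r∈R)
  ... | t , bt∈B , b[1+t]∈R =
    b ⊕ t , ⊕<n b t , bt∈B , trans (cong s (trans (⊕-assoc b t 1) (cong (b ⊕_) (+-comm t 1)))) b[1+t]∈R

  count-rotate : ∀ g {c} → c < n → count g 0 n ≡ count (g ∘ (c ⊕_)) 0 n
  count-rotate g {c} c<n = begin
    count g 0 n                                                ≡⟨ cong (count g 0) (sym (m+[n∸m]≡n (<⇒≤ c<n))) ⟩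
    count g 0 (c + (n ∸ c))                                    ≡⟨ count-++ g 0 c (n ∸ c) ⟩
    count g 0 c + count g c (n ∸ c)                            ≡⟨ +-comm (count g 0 c) _ ⟩
    count g c (n ∸ c) + count g 0 c                            ≡⟨ cong₂ _+_ (count-shift g c (n ∸ c)) (count-cong 0 c head) ⟩
    count (λ t → g (c + t)) 0 (n ∸ c) + count (λ t → g (c ⊕ (n ∸ c + t))) 0 c
                                                               ≡⟨ cong₂ _+_ (count-cong 0 (n ∸ c) tail) (sym (count-shift (g ∘ (c ⊕_)) (n ∸ c) c)) ⟩
    count (g ∘ (c ⊕_)) 0 (n ∸ c) + count (g ∘ (c ⊕_)) (n ∸ c) c ≡⟨ sym (count-++ (g ∘ (c ⊕_)) 0 (n ∸ c) c) ⟩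
    count (g ∘ (c ⊕_)) 0 (n ∸ c + c)                           ≡⟨ cong (count (g ∘ (c ⊕_)) 0) (m∸n+n≡m (<⇒≤ c<n)) ⟩
    count (g ∘ (c ⊕_)) 0 n                                     ∎
    where
    open ≡-Reasoning
    tail : OnRange 0 (n ∸ c) (λ t → g (c + t) ≡ g (c ⊕ t))
    tail t _ t<n∸c = cong g (sym (m<n⇒m%n≡m (subst (c + t <_) (m+[n∸m]≡n (<⇒≤ c<n)) (+-monoʳ-< c t<n∸c))))
    head : OnRange 0 c (λ t → g t ≡ g (c ⊕ (n ∸ c + t)))
    head t _ t<c = cong g (sym (begin
      c ⊕ (n ∸ c + t)     ≡⟨ cong (_% n) (sym (+-assoc c (n ∸ c) t)) ⟩
      (c + (n ∸ c) + t) % n ≡⟨ cong (λ z → (z + t) % n) (m+[n∸m]≡n (<⇒≤ c<n)) ⟩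
      (n + t) % n          ≡⟨ cong (_% n) (+-comm n t) ⟩
      (t + n) % n          ≡⟨ [m+n]%n≡m%n t n ⟩
      t % n                ≡⟨ m<n⇒m%n≡m (<-trans t<c c<n) ⟩
      t                    ∎))

module CycleWithChords (n p : ℕ) {{_ : NonZero n}} (chord : ℕ → Bool) (2p+3≤n : 3 + (p + p) ≤ n) where

  open Cyclic n

  -- step x m: x ⊕ m is joined to x by an edge of length m going forward from x.
  short : ℕ → Bool
  short m = does (1 ≤? m) ∧ does (m ≤? p)

  step : ℕ → ℕ → Bool
  step x m = short m ∨ (chord x ∧ does (m ≟ suc p))

  adjacent : ℕ → ℕ → Bool
  adjacent x y = step x (y ⊖ x) ∨ step y (x ⊖ y)

  adjacent-sym : ∀ x y → adjacent x y ≡ adjacent y x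
  adjacent-sym x y = ∨-comm (step x (y ⊖ x)) _

  adjacent-irrefl : ∀ {x} → x < n → adjacent x x ≡ false
  adjacent-irrefl {x} x<n rewrite ⊖-self x<n | ∧-zeroʳ (chord x) = refl

  p<n : p < n
  p<n = ≤-trans (s≤s (≤-trans (m≤m+n p p) (m≤n+m _ 2))) 2p+3≤n

  1+p<n : suc p < n
  1+p<n = ≤-trans (s≤s (s≤s (m≤m+n p p))) (≤-trans (n≤1+n _) 2p+3≤n)

  step-short : ∀ {x m} → 1 ≤ m → m ≤ p → step x m ≡ true
  step-short {x} {m} 1≤m m≤p rewrite dec-true (1 ≤? m) 1≤m | dec-true (m ≤? p) m≤p = refl

  step-chord : ∀ x → step x (suc p) ≡ chord x
  step-chord x rewrite dec-false (suc p ≤? p) (1+n≰n) | dec-true (suc p ≟ suc p) refl = ∧-identityʳ (chord x)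

  step-long : ∀ {x m} → suc p < m → step x m ≡ false
  step-long {x} {m} 1+p<m
    rewrite dec-false (m ≤? p) (λ m≤p → <⇒≱ 1+p<m (m≤n⇒m≤1+n m≤p))
          | dec-false (m ≟ suc p) (λ { refl → <-irrefl refl 1+p<m })
          | ∧-zeroʳ (does (1 ≤? m)) = ∧-zeroʳ (chord x)

  step-bounds : ∀ {x m} → T (step x m) → 1 ≤ m × m ≤ suc p
  step-bounds {x} {m} h with Equivalence.to T-∨ h
  ... | inj₁ sh = does-witness (1 ≤? m) (proj₁ bounds) , m≤n⇒m≤1+n (does-witness (m ≤? p) (proj₂ bounds))
    where bounds = Equivalence.to T-∧ sh
  ... | inj₂ ch = subst (λ k → 1 ≤ k × k ≤ suc p) (sym m≡1+p) (s≤s z≤n , ≤-refl)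
    where m≡1+p = does-witness (m ≟ suc p) (proj₂ (Equivalence.to (T-∧ {chord x}) ch))

  adjacent-offset : ∀ {i m} → i < n → 0 < m → m < n → adjacent i (i ⊕ m) ≡ step i m ∨ step (i ⊕ m) (n ∸ m)
  adjacent-offset {i} {m} i<n 0<m m<n rewrite ⊖-⊕ i<n m<n | ⊖-⊕-back i<n 0<m m<n = refl

  adjacent-near : ∀ {i m} → i < n → 1 ≤ m → m ≤ p → adjacent i (i ⊕ m) ≡ true
  adjacent-near {i} i<n 1≤m m≤p
    rewrite adjacent-offset i<n 1≤m (≤-<-trans m≤p p<n) | step-short {i} 1≤m m≤p = refl

  adjacent-far : ∀ {i m} → i < n → m < n → n ≤ m + p → adjacent i (i ⊕ m) ≡ true
  adjacent-far {i} {m} i<n m<n n≤m+p = begin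
    adjacent i (i ⊕ m)              ≡⟨ adjacent-offset i<n 0<m m<n ⟩
    step i m ∨ step (i ⊕ m) (n ∸ m) ≡⟨ cong (step i m ∨_) (step-short (m<n⇒0<n∸m m<n) (m≤n+o⇒m∸n≤o n m n≤m+p)) ⟩
    step i m ∨ true                 ≡⟨ ∨-zeroʳ (step i m) ⟩
    true                            ∎
    where
    open ≡-Reasoning
    0<m : 0 < m
    0<m = +-cancelʳ-< p 0 m (<-≤-trans p<n n≤m+p)

  adjacent-gap : ∀ {i m} → i < n → m < n → suc p < m → suc p < n ∸ m → adjacent i (i ⊕ m) ≡ false
  adjacent-gap {i} {m} i<n m<n 1+p<m 1+p<n∸m
    rewrite adjacent-offset i<n (<-trans z<s 1+p<m) m<n
          | step-long {i} 1+p<m | step-long {i ⊕ m} 1+p<n∸m = refl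

  2+p+[1+p]≤n : suc (suc p) + suc p ≤ n
  2+p+[1+p]≤n = subst (_≤ n) (cong (2 +_) (sym (+-suc p p))) 2p+3≤n

  adjacent-chord-ahead : ∀ {i} → i < n → adjacent i (i ⊕ suc p) ≡ chord i
  adjacent-chord-ahead {i} i<n
    rewrite adjacent-offset i<n z<s 1+p<n | step-chord i
          | step-long {i ⊕ suc p} (m+n≤o⇒m≤o∸n (suc (suc p)) 2+p+[1+p]≤n) = ∨-identityʳ (chord i)

  adjacent-chord-behind : ∀ {i m} → i < n → m + suc p ≡ n → adjacent i (i ⊕ m) ≡ chord (i ⊕ m)
  adjacent-chord-behind {i} {m} i<n m+1+p≡n = begin
    adjacent i (i ⊕ m)                   ≡⟨ adjacent-offset i<n (<-trans z<s 1+p<m) m<n ⟩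
    step i m ∨ step (i ⊕ m) (n ∸ m)      ≡⟨ cong₂ _∨_ (step-long 1+p<m) (cong (step (i ⊕ m)) n∸m≡1+p) ⟩
    false ∨ step (i ⊕ m) (suc p)         ≡⟨ step-chord (i ⊕ m) ⟩
    chord (i ⊕ m)                        ∎
    where
    open ≡-Reasoning
    m<n : m < n
    m<n = subst (m <_) m+1+p≡n (m<m+n m z<s)
    n∸m≡1+p : n ∸ m ≡ suc p
    n∸m≡1+p = trans (cong (_∸ m) (sym m+1+p≡n)) (m+n∸m≡n m (suc p))
    1+p<m : suc p < m
    1+p<m = +-cancelʳ-≤ (suc p) (suc (suc p)) m (subst (suc (suc p) + suc p ≤_) (sym m+1+p≡n) 2+p+[1+p]≤n)

  degree-at : ∀ {i} → i < n →
              count (adjacent i) 0 n ≡ p + p + (bit (chord i) + bit (chord (i ⊕ (n ∸ suc p))))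
  degree-at {i} i<n = begin
    count (adjacent i) 0 n                                   ≡⟨ count-rotate (adjacent i) i<n ⟩
    count R 0 n                                              ≡⟨ cong (count R 0) (sym farStart+p≡n) ⟩
    count R 0 (farStart + p)                                       ≡⟨ around ⟩
    p + bit (chord i) + 0 + bit (chord (i ⊕ backChord)) + p         ≡⟨ rearrange p (bit (chord i)) _ ⟩
    p + p + (bit (chord i) + bit (chord (i ⊕ backChord)))           ≡⟨ cong (λ m → p + p + (bit (chord i) + bit (chord (i ⊕ m)))) backChord≡n∸[1+p] ⟩
    p + p + (bit (chord i) + bit (chord (i ⊕ (n ∸ suc p)))) ∎
    where
    open ≡-Reasoning
    R : ℕ → Bool
    R m = adjacent i (i ⊕ m)
    -- offsets from i: 0 | 1 … p | p + 1 | gap | n − p − 1 | n − p … n − 1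
    q gapStart backChord farStart : ℕ
    q  = n ∸ (3 + (p + p))
    gapStart = 1 + p + 1
    backChord = gapStart + q
    farStart = backChord + 1
    backChord+[1+p]≡n : backChord + suc p ≡ n
    backChord+[1+p]≡n = trans (shuffle p q) (m∸n+n≡m 2p+3≤n)
      where
      shuffle : ∀ p q → 1 + p + 1 + q + suc p ≡ q + (3 + (p + p))
      shuffle = solve-∀
    farStart+p≡n : farStart + p ≡ n
    farStart+p≡n = trans (+-assoc backChord 1 p) backChord+[1+p]≡n
    backChord≡n∸[1+p] : backChord ≡ n ∸ suc p
    backChord≡n∸[1+p] = trans (sym (m+n∸n≡m backChord (suc p))) (cong (_∸ suc p) backChord+[1+p]≡n)
    rearrange : ∀ p a b → p + a + 0 + b + p ≡ p + p + (a + b)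
    rearrange = solve-∀

    near : OnRange 1 p (λ t → R t ≡ true)
    near t 1≤t t<1+p = adjacent-near i<n 1≤t (s≤s⁻¹ t<1+p)
    gap : OnRange gapStart q (λ t → R t ≡ false)
    gap t gapStart≤t t<backChord = adjacent-gap i<n t<n 1+p<t 1+p<n∸t
      where
      t<n = <-≤-trans t<backChord (subst (backChord ≤_) backChord+[1+p]≡n (m≤m+n backChord (suc p)))
      1+p<t = subst (_≤ t) (cong suc (+-comm p 1)) gapStart≤t
      1+p<n∸t : suc p < n ∸ t
      1+p<n∸t = subst (suc p <_) (trans (sym (+-∸-comm (suc p) (<⇒≤ t<backChord))) (cong (_∸ t) backChord+[1+p]≡n))
                      (+-monoˡ-< (suc p) (m<n⇒0<n∸m t<backChord))
    far : OnRange farStart p (λ t → R t ≡ true)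
    far t farStart≤t t<farStart+p =
      adjacent-far i<n (subst (t <_) farStart+p≡n t<farStart+p) (subst (_≤ t + p) farStart+p≡n (+-monoˡ-≤ p farStart≤t))

    upto : ∀ a l {x y} → count R 0 a ≡ x → count R a l ≡ y → count R 0 (a + l) ≡ x + y
    upto a l prefix segment = trans (count-++ R 0 a l) (cong₂ _+_ prefix segment)

    around : count R 0 (farStart + p) ≡ p + bit (chord i) + 0 + bit (chord (i ⊕ backChord)) + p
    around = upto farStart p to-farStart (count-true farStart p far)
      where
      to-1 : count R 0 1 ≡ 0
      to-1 = trans (count-one R 0) (cong bit (trans (cong (adjacent i) (⊕-identityʳ i<n)) (adjacent-irrefl i<n)))
      to-1+p : count R 0 (1 + p) ≡ p
      to-1+p = upto 1 p to-1 (count-true 1 p near)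
      to-gapStart : count R 0 gapStart ≡ p + bit (chord i)
      to-gapStart = upto (1 + p) 1 to-1+p (trans (count-one R (1 + p)) (cong bit (adjacent-chord-ahead i<n)))
      to-backChord : count R 0 backChord ≡ p + bit (chord i) + 0
      to-backChord = upto gapStart q to-gapStart (count-false gapStart q gap)
      to-farStart : count R 0 farStart ≡ p + bit (chord i) + 0 + bit (chord (i ⊕ backChord))
      to-farStart = upto backChord 1 to-backChord (trans (count-one R backChord) (cong bit (adjacent-chord-behind i<n backChord+[1+p]≡n)))

  adjacent-close : ∀ c {a b} → a < b → b < n → b ≤ a + p → adjacent (c ⊕ a) (c ⊕ b) ≡ true
  adjacent-close c {a} {b} a<b b<n b≤a+p
    rewrite ⊖-shift c (<⇒≤ a<b) b<n
          | step-short {c ⊕ a} (m<n⇒0<n∸m a<b) (m≤n+o⇒m∸n≤o b a b≤a+p) = refl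

  adjacent-within : ∀ c {a b} → a ≢ b → a < n → b < n → a ≤ b + p → b ≤ a + p →
                    adjacent (c ⊕ a) (c ⊕ b) ≡ true
  adjacent-within c {a} {b} a≢b a<n b<n a≤b+p b≤a+p with <-cmp a b
  ... | tri< a<b _ _ = adjacent-close c a<b b<n b≤a+p
  ... | tri≈ _ a≡b _ = contradiction a≡b a≢b
  ... | tri> _ _ b<a = trans (adjacent-sym (c ⊕ a) (c ⊕ b)) (adjacent-close c b<a a<n a≤b+p)

  Clustered : (ℕ → Set) → Set
  Clustered P = ∀ {a b} → P a → P b → b ≤ a + p

  clustered-adjacent : ∀ {P} → Clustered P → ∀ {v x y} → v < n → x < n → y < n → x ≢ y →
                       P (x ⊖ v) → P (y ⊖ v) → adjacent x y ≡ true
  clustered-adjacent cl {v} {x} {y} v<n x<n y<n x≢y Px Py =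
    subst₂ (λ a b → adjacent a b ≡ true) (⊕-⊖ v<n x<n) (⊕-⊖ v<n y<n)
      (adjacent-within v (x≢y ∘ ⊖-injective v<n x<n y<n) (⊖<n x v) (⊖<n y v) (cl Py Px) (cl Px Py))

  Ahead Behind : ℕ → Set
  Ahead m  = 1 ≤ m × m ≤ suc p
  Behind m = m < n × n ≤ m + suc p

  ahead-clustered : Clustered Ahead
  ahead-clustered (1≤a , _) (_ , b≤1+p) = ≤-trans b≤1+p (+-monoˡ-≤ p 1≤a)

  behind-clustered : Clustered Behind
  behind-clustered {a} (_ , n≤a+1+p) (b<n , _) = s≤s⁻¹ (≤-trans b<n (subst (n ≤_) (+-suc a p) n≤a+1+p))

  neighbour-offset : ∀ {v y} → v < n → y < n → T (adjacent v y) → Ahead (y ⊖ v) ⊎ Behind (y ⊖ v)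
  neighbour-offset {v} {y} v<n y<n v~y with Equivalence.to T-∨ v~y
  ... | inj₁ forward  = inj₁ (step-bounds forward)
  ... | inj₂ backward = inj₂ (⊖<n y v , subst (λ z → n ≤ z + suc p) (sym y⊖v≡n∸m) n≤n∸m+1+p)
    where
    m = v ⊖ y
    m<n = ⊖<n v y
    y⊖v≡n∸m : y ⊖ v ≡ n ∸ m
    y⊖v≡n∸m = trans (cong (y ⊖_) (sym (⊕-⊖ y<n v<n))) (⊖-⊕-back y<n (proj₁ (step-bounds backward)) m<n)
    n≤n∸m+1+p : n ≤ n ∸ m + suc p
    n≤n∸m+1+p = subst (_≤ n ∸ m + suc p) (m∸n+n≡m (<⇒≤ m<n)) (+-monoʳ-≤ (n ∸ m) (proj₂ (step-bounds backward)))

  crossings : (ℕ → Bool) → ℕ → ℕ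
  crossings side x = count (λ y → adjacent x y ∧ (side x xor side y)) 0 n

  window-crossings : ∀ side {c} → c < n → side (c ⊕ p) ≡ true → side (c ⊕ suc p) ≡ false →
                     p + p ≤ crossings side (c ⊕ p) + crossings side (c ⊕ suc p)
  window-crossings side {c} c<n c⊕p∈B c⊕[1+p]∈R = begin
    p + p                                                   ≡⟨ sym (count-true 1 (p + p) window) ⟩
    count W 1 (p + p)                                       ≤⟨ count-subrange W 1 (p + p) n 2p<n ⟩
    count W 0 n                                             ≤⟨ count-∨ across-i across-j 0 n ⟩
    count across-i 0 n + count across-j 0 n                 ≡⟨ sym (cong₂ _+_ (count-rotate (cut i) c<n) (count-rotate (cut j) c<n)) ⟩
    crossings side (c ⊕ p) + crossings side (c ⊕ suc p)     ∎
    where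
    open ≤-Reasoning
    i j : ℕ
    i = c ⊕ p
    j = c ⊕ suc p
    cut : ℕ → ℕ → Bool
    cut x y = adjacent x y ∧ (side x xor side y)
    across-i across-j W : ℕ → Bool
    across-i m = cut i (c ⊕ m)
    across-j m = cut j (c ⊕ m)
    W m = across-i m ∨ across-j m
    2p<n : 1 + (p + p) ≤ n
    2p<n = ≤-trans (n≤1+n _) (≤-trans (n≤1+n _) 2p+3≤n)
    window : OnRange 1 (p + p) (λ m → W m ≡ true)
    window m 1≤m m<1+2p with side (c ⊕ m) in c⊕m-side
    ... | false rewrite c⊕p∈B
                      | adjacent-within c {p} {m} (λ { refl → contradiction (trans (sym c⊕p∈B) c⊕m-side) λ () })
                          p<n (<-≤-trans m<1+2p 2p<n) (m≤n+m p m) (s≤s⁻¹ m<1+2p) = refl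
    ... | true  rewrite c⊕[1+p]∈R
                      | adjacent-within c {suc p} {m} (λ { refl → contradiction (trans (sym c⊕m-side) c⊕[1+p]∈R) λ () })
                          1+p<n (<-≤-trans m<1+2p 2p<n) (+-monoˡ-≤ p 1≤m) (m≤n⇒m≤1+n (s≤s⁻¹ m<1+2p)) = ∨-zeroʳ _

  boundary-crossings : ∀ side {i} → i < n → side i ≡ true → side (i ⊕ 1) ≡ false →
                       p + p ≤ crossings side i + crossings side (i ⊕ 1)
  boundary-crossings side {i} i<n i∈B i⊕1∈R =
    subst₂ (λ x y → p + p ≤ crossings side x + crossings side y) c⊕p≡i c⊕[1+p]≡i⊕1
      (window-crossings side (⊕<n i (n ∸ p)) (trans (cong side c⊕p≡i) i∈B) (trans (cong side c⊕[1+p]≡i⊕1) i⊕1∈R))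
    where
    c = i ⊕ (n ∸ p)
    c⊕p≡i : c ⊕ p ≡ i
    c⊕p≡i = ⊕-cancel (n ∸ p) p i<n (m∸n+n≡m (<⇒≤ p<n))
    c⊕[1+p]≡i⊕1 : c ⊕ suc p ≡ i ⊕ 1
    c⊕[1+p]≡i⊕1 = trans (cong (c ⊕_) (+-comm 1 p)) (trans (sym (⊕-assoc c p 1)) (cong (_⊕ 1) c⊕p≡i))

  G : Graph n
  G = record
    { adj        = λ u v → adjacent (toℕ u) (toℕ v)
    ; adj-sym    = λ u v → adjacent-sym (toℕ u) (toℕ v)
    ; adj-irrefl = λ v → adjacent-irrefl (toℕ<n v)
    }

  degree-G : ∀ v → degree G v ≡ p + p + (bit (chord (toℕ v)) + bit (chord (toℕ v ⊕ (n ∸ suc p))))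
  degree-G v = trans (countTrue≡count {n} (adjacent (toℕ v))) (degree-at (toℕ<n v))

  clawFree : ClawFree G
  clawFree v a b c v~a v~b v~c a≢b a≢c b≢c (a≁b , a≁c , b≁c)
    with pigeonhole (λ x y → x ≢ y → adj G x y ≡ true) (joined ahead-clustered) (joined behind-clustered)
                    (side v~a) (side v~b) (side v~c)
    where
    side : ∀ {x} → T (adj G v x) → Ahead (toℕ x ⊖ toℕ v) ⊎ Behind (toℕ x ⊖ toℕ v)
    side {x} = neighbour-offset (toℕ<n v) (toℕ<n x)
    joined : ∀ {P} → Clustered P → ∀ {x y} → P (toℕ x ⊖ toℕ v) → P (toℕ y ⊖ toℕ v) → x ≢ y → adj G x y ≡ true
    joined cl {x} {y} Px Py x≢y =
      clustered-adjacent cl (toℕ<n v) (toℕ<n x) (toℕ<n y) (x≢y ∘ toℕ-injective) Px Py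
  ... | inj₁ a~b        = contradiction (trans (sym (a~b a≢b)) a≁b) λ ()
  ... | inj₂ (inj₁ a~c) = contradiction (trans (sym (a~c a≢c)) a≁c) λ ()
  ... | inj₂ (inj₂ b~c) = contradiction (trans (sym (b~c b≢c)) b≁c) λ ()

  crossings-countTrue : ∀ side v →
    countTrue (λ u → adj G v u ∧ (side v xor side u)) ≡ crossings (extend side) (toℕ v)
  crossings-countTrue side v = trans
    (countTrue-cong λ u → cong₂ (λ y z → adj G v u ∧ (y xor z)) (sym (extend-toℕ side v)) (sym (extend-toℕ side u)))
    (countTrue≡count {n} (λ y → adjacent (toℕ v) y ∧ (extend side (toℕ v) xor extend side y)))

  noCut : ∀ {d} → d < p → ¬ HasDCut d G
  noCut {d} d<p (_ , side , ((b , b∈B) , (r , r∈R) , few) , _)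
    with true→false-around (extend side) (toℕ<n b) (toℕ<n r)
           (trans (extend-toℕ side b) b∈B) (trans (extend-toℕ side r) r∈R)
  ... | i , i<n , i∈B , i⊕1∈R = <⇒≱ (+-mono-< d<p d<p) (begin
    p + p                                                    ≤⟨ boundary-crossings (extend side) i<n i∈B i⊕1∈R ⟩
    crossings (extend side) i + crossings (extend side) (i ⊕ 1) ≤⟨ +-mono-≤ (at-most-d i<n) (at-most-d (⊕<n i 1)) ⟩
    d + d                                                    ∎)
    where
    open ≤-Reasoning
    at-most-d : ∀ {x} → x < n → crossings (extend side) x ≤ d
    at-most-d {x} x<n = subst (λ y → crossings (extend side) y ≤ d) (toℕ-fromℕ< x<n)
      (subst (_≤ d) (crossings-countTrue side (fromℕ< x<n)) (few (fromℕ< x<n)))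

alternating : ℕ → ℕ → Bool
alternating p x = x % (suc p + suc p) <ᵇ suc p

alternating-shift : ∀ p x → alternating p (x + suc p) ≡ not (alternating p x)
alternating-shift p x = begin
  (x + s) % B <ᵇ s                       ≡⟨ cong (_<ᵇ s) (sym (%-absorbˡ x s B)) ⟩
  (x % B + s) % B <ᵇ s                   ≡⟨ half-turn (x % B) (m%n<n x B) ⟩
  not (x % B <ᵇ s)                       ∎
  where
  open ≡-Reasoning
  s = suc p
  B = s + s
  half-turn : ∀ q → q < B → ((q + s) % B <ᵇ s) ≡ not (q <ᵇ s)
  half-turn q q<B with q <? s
  ... | yes q<s rewrite dec-true (q <? s) q<s | m<n⇒m%n≡m (+-monoˡ-< s q<s) =
    dec-false (q + s <? s) (λ q+s<s → <⇒≱ q+s<s (m≤n+m s q))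
  ... | no q≮s rewrite dec-false (q <? s) q≮s = begin
    (q + s) % B <ᵇ s             ≡⟨ cong (λ z → (z + s) % B <ᵇ s) (sym (m∸n+n≡m (≮⇒≥ q≮s))) ⟩
    (q ∸ s + s + s) % B <ᵇ s     ≡⟨ cong (λ z → z % B <ᵇ s) (+-assoc (q ∸ s) s s) ⟩
    (q ∸ s + B) % B <ᵇ s         ≡⟨ cong (_<ᵇ s) ([m+n]%n≡m%n (q ∸ s) B) ⟩
    (q ∸ s) % B <ᵇ s             ≡⟨ cong (_<ᵇ s) (m<n⇒m%n≡m (≤-<-trans (m∸n≤m q s) q<B)) ⟩
    q ∸ s <ᵇ s                   ≡⟨ dec-true (q ∸ s <? s) (m<n+o⇒m∸n<o q s q<B) ⟩
    true                         ∎

module _ (n : ℕ) {{_ : NonZero n}} where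

  open Cyclic n

  alternating-⊕ : ∀ p → suc p + suc p ∣ n → ∀ x → alternating p (x ⊕ (n ∸ suc p)) ≡ not (alternating p x)
  alternating-⊕ p B∣n x = begin
    (x + (n ∸ s)) % n % B <ᵇ s      ≡⟨ cong (_<ᵇ s) (m∣n⇒o%n%m≡o%m B n (x + (n ∸ s)) B∣n) ⟩
    (x + (n ∸ s)) % B <ᵇ s          ≡⟨ cong (_<ᵇ s) (sym ([m+n]%n≡m%n (x + (n ∸ s)) B)) ⟩
    (x + (n ∸ s) + B) % B <ᵇ s      ≡⟨ cong (λ z → z % B <ᵇ s) (trans (shuffle x (n ∸ s) s) (cong (x + s +_) (m∸n+n≡m s≤n))) ⟩
    (x + s + n) % B <ᵇ s            ≡⟨ cong (_<ᵇ s) (%-remove-+ʳ (x + s) B∣n) ⟩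
    alternating p (x + s)           ≡⟨ alternating-shift p x ⟩
    not (alternating p x)           ∎
    where
    open ≡-Reasoning
    s = suc p
    B = s + s
    s≤n : s ≤ n
    s≤n = ≤-trans (m≤m+n s s) (∣⇒≤ B∣n)
    shuffle : ∀ x m s → x + m + (s + s) ≡ x + s + (m + s)
    shuffle = solve-∀

  alternating-chords-balanced : ∀ p b → (T b → suc p + suc p ∣ n) → ∀ x →
    bit (b ∧ alternating p x) + bit (b ∧ alternating p (x ⊕ (n ∸ suc p))) ≡ bit b
  alternating-chords-balanced p false _   x = refl
  alternating-chords-balanced p true  B∣n x rewrite alternating-⊕ p (B∣n _) x with alternating p x
  ... | true  = refl
  ... | false = refl

halve : ∀ r → ∃₂ λ p b → r ≡ p + p + bit b
halve zero          = 0 , false , refl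
halve (suc zero)    = 0 , true , refl
halve (suc (suc r)) with halve r
... | p , b , refl  = suc p , b , cong (λ z → suc (z + bit b)) (sym (+-suc p p))

below-half : ∀ {d p} b → 2 * d + 2 ≤ p + p + bit b → d < p
below-half {d} {p} b 2d+2≤r = ≰⇒> λ p≤d → <⇒≱ (begin-strict
  p + p + bit b  ≤⟨ +-mono-≤ (+-mono-≤ p≤d p≤d) (bit≤1 b) ⟩
  d + d + 1      <⟨ n<1+n _ ⟩
  suc (d + d + 1) ≡⟨ shuffle d ⟩
  2 * d + 2      ∎) 2d+2≤r
  where
  open ≤-Reasoning
  bit≤1 : ∀ b → bit b ≤ 1
  bit≤1 true  = ≤-refl
  bit≤1 false = z≤n
  shuffle : ∀ d → suc (d + d + 1) ≡ 2 * d + 2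
  shuffle = solve-∀

long-enough : ∀ {p r k} → 1 ≤ p → p + p ≤ r → 2 ≤ k → 3 + (p + p) ≤ (r + 1) * k
long-enough {suc p} {r} {k} _ 2p≤r 2≤k = begin
  3 + (suc p + suc p)                 ≤⟨ m≤m+n _ (suc (p + p)) ⟩
  3 + (suc p + suc p) + suc (p + p)   ≡⟨ shuffle p ⟩
  (suc p + suc p + 1) * 2   ≤⟨ *-mono-≤ (+-monoˡ-≤ 1 2p≤r) 2≤k ⟩
  (r + 1) * k               ∎
  where
  open ≤-Reasoning
  shuffle : ∀ p → 3 + (suc p + suc p) + suc (p + p) ≡ (suc p + suc p + 1) * 2
  shuffle = solve-∀

period-divides : ∀ p k b → T b → suc p + suc p ∣ (p + p + bit b + 1) * k
period-divides p k true _ = divides k (shuffle p k)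
  where
  shuffle : ∀ p k → (p + p + 1 + 1) * k ≡ k * (suc p + suc p)
  shuffle = solve-∀

theorem3p3 : ∀ (d k r : ℕ) → 2 ≤ d → 2 ≤ k → 2 * d + 2 ≤ r →
    Σ (Graph ((r + 1) * k)) λ G → ClawFree G × Regular r G × ¬ HasDCut d G
theorem3p3 d k r _ 2≤k 2d+2≤r with halve r
... | p , b , refl = G , clawFree , regular , noCut d<p
  where
  d<p : d < p
  d<p = below-half b 2d+2≤r
  n = (p + p + bit b + 1) * k
  2p+3≤n : 3 + (p + p) ≤ n
  2p+3≤n = long-enough (≤-trans (s≤s z≤n) d<p) (m≤m+n (p + p) (bit b)) 2≤k
  instance
    n-nonZero : NonZero n
    n-nonZero = >-nonZero (≤-trans (s≤s z≤n) 2p+3≤n)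
  chord : ℕ → Bool
  chord x = b ∧ alternating p x
  open CycleWithChords n p chord 2p+3≤n
  regular : Regular (p + p + bit b) G
  regular v = trans (degree-G v)
    (cong (p + p +_) (alternating-chords-balanced n p b (period-divides p k b) (toℕ v)))
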